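{- Let $\mathcal{M}$ be a regular structure, $\mathcal{K}\in B(\mathcal{M})$, and let $P=\triangle_\mathcal{K}$ (respectively, $P=\triangledown_\mathcal{K}$). Then $P$ is closed under permutations if and only if $\mathcal{K}$ is closed under permutations.
   Context: A structure is regular if it is relational and no two distinct signature symbols have the same interpretation. For a regular $\mathcal{M}$ with universe $M$, $\overline{\mathcal{M}}$ is a maximal regular expansion of $\mathcal{M}$ on $M$ (every finitary relation on $M$ named by exactly one symbol), $B(\mathcal{M})$ is the set of restrictions of $\overline{\mathcal{M}}$ to subsignatures (universe $M$), ordered by $\mathcal{N}_1\le\mathcal{N}_2$ iff $\mathcal{N}_2$ expands $\mathcal{N}_1$; $\triangledown_\mathcal{K}=\{\mathcal{N}:\mathcal{K}\le\mathcal{N}\}$, $\triangle_\mathcal{K}=\{\mathcal{N}:\mathcal{N}\le\mathcal{K}\}$. For a permutation $f$ of $M$ and $\mathcal{N}\in B(\mathcal{M})$, $f(\mathcal{N})\in B(\mathcal{M})$ is the structure whose signature relations are exactly the relations $f(Q)=\{f(\bar a):\bar a\in Q\}$ for the signature relations $Q$ of $\mathcal{N}$ (each named by its symbol in $\overline{\mathcal{M}}$). A set $P\subseteq B(\mathcal{M})$ is closed under permutations if $f(\mathcal{N})\in P$ for every permutation $f$ of $M$ and every $\mathcal{N}\in P$. A structure $\mathcal{N}$ is closed under permutations if $\{\mathcal{N}\}$ is, i.e. every permutation of the universe maps the set of signature relations of $\mathcal{N}$ onto itself. -}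

module Defs where

open import Data.Nat using (ℕ)
open import Data.Vec using (Vec; map)
open import Data.Product using (Σ; ∃; _×_; _,_)
open import Function using (_↔_; _⇔_; Inverse)
open import Relation.Binary.PropositionalEquality using (_≡_)
open import Function.Properties.Equivalence using () renaming (sym to ⇔-sym; trans to ⇔-trans)

FinRel : Set → Set₁
FinRel M = Σ ℕ (λ n → Vec M n → Set)

data _≅ᴿ_ {M : Set} : FinRel M → FinRel M → Set₁ where
  same : ∀ {n} {Q R : Vec M n → Set} → (∀ v → Q v ⇔ R v) → (n , Q) ≅ᴿ (n , R)

-- An element of B(M): a restriction of the maximal regular expansion of M to a
-- subsignature.  Since every finitary relation on M is named by exactly one
-- symbol, such a structure is determined by (and identified with) its set of
-- signature relations, a set of finitary relations on M (respecting equality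
-- of relations).
record BStr (M : Set) : Set₂ where
  field
    rel : FinRel M → Set₁
    rel-resp : ∀ {Q R} → Q ≅ᴿ R → rel Q → rel R
open BStr public

_≤ᴮ_ : {M : Set} → BStr M → BStr M → Set₁
N₁ ≤ᴮ N₂ = ∀ Q → rel N₁ Q → rel N₂ Q

imgRel : {M : Set} → (M → M) → FinRel M → FinRel M
imgRel f (n , Q) = n , (λ b → ∃ λ a → Q a × map f a ≡ b)

permStr : {M : Set} → (M ↔ M) → BStr M → BStr M
rel (permStr f N) R = ∃ λ Q → rel N Q × (R ≅ᴿ imgRel (Inverse.to f) Q)
rel-resp (permStr f N) (same e) ((n , Q) , q , same e') =
  (n , Q) , q , same (λ v → ⇔-trans (⇔-sym (e v)) (e' v))

△ : {M : Set} → BStr M → BStr M → Set₁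
△ K N = N ≤ᴮ K

▽ : {M : Set} → BStr M → BStr M → Set₁
▽ K N = K ≤ᴮ N

SetClosedUnderPerm : {M : Set} → (BStr M → Set₁) → Set₂
SetClosedUnderPerm {M} P = ∀ (f : M ↔ M) (N : BStr M) → P N → P (permStr f N)

-- A structure N is closed under permutations iff {N} is: f(N) = N for all
-- permutations f (equality in B(M) = same set of signature relations).
StrClosedUnderPerm : {M : Set} → BStr M → Set₁
StrClosedUnderPerm {M} N = ∀ (f : M ↔ M) → (permStr f N ≤ᴮ N) × (N ≤ᴮ permStr f N)

module Submission where

open import Defs
open import Data.Nat using (ℕ)
open import Data.Product using (_×_; _,_; proj₁; proj₂)
open import Data.Vec using (Vec; map)
open import Data.Vec.Properties using (map-∘; map-cong; map-id)
open import Function using (_⇔_; _↔_; Inverse; mk⇔)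
open import Function.Properties.Inverse using (↔-sym)
open import Function.Properties.Equivalence using ()
  renaming (refl to ⇔-refl; sym to ⇔-sym; trans to ⇔-trans)
open import Relation.Binary.PropositionalEquality using (_≡_; refl; sym; trans; subst)

-- A permutation acts on B(M) as an order automorphism whose inverse is the action
-- of f⁻¹.  Hence each of the one-sided conditions f(K) ≤ K for all f, or K ≤ f(K)
-- for all f, already forces f(K) = K; and △_K (resp. ▽_K) is closed under
-- permutations exactly when the first (resp. second) condition holds.

module _ {M : Set} where

  ≅ᴿ-refl : {Q : FinRel M} → Q ≅ᴿ Q
  ≅ᴿ-refl {_ , Q} = same (λ _ → ⇔-refl)

  ≅ᴿ-sym : {Q R : FinRel M} → Q ≅ᴿ R → R ≅ᴿ Q
  ≅ᴿ-sym (same e) = same (λ v → ⇔-sym (e v))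

  ≅ᴿ-trans : {Q R S : FinRel M} → Q ≅ᴿ R → R ≅ᴿ S → Q ≅ᴿ S
  ≅ᴿ-trans (same e) (same e′) = same (λ v → ⇔-trans (e v) (e′ v))

  imgRel-resp-≅ᴿ : (g : M → M) {Q R : FinRel M} → Q ≅ᴿ R → imgRel g Q ≅ᴿ imgRel g R
  imgRel-resp-≅ᴿ g (same e) = same (λ b → mk⇔
    (λ { (a , q , p) → a , Function.Equivalence.to (e a) q , p })
    (λ { (a , q , p) → a , Function.Equivalence.from (e a) q , p }))

  map-inverseˡ : (f : M ↔ M) {n : ℕ} (c : Vec M n) →
                 map (Inverse.to f) (map (Inverse.from f) c) ≡ c
  map-inverseˡ f c = trans (sym (map-∘ (Inverse.to f) (Inverse.from f) c))
                           (trans (map-cong (Inverse.strictlyInverseˡ f) c) (map-id c))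

  imgRel-inverseˡ : (f : M ↔ M) (Q : FinRel M) →
                    Q ≅ᴿ imgRel (Inverse.to f) (imgRel (Inverse.from f) Q)
  imgRel-inverseˡ f (n , Q) = same (λ b → mk⇔
    (λ q → map (Inverse.from f) b , (b , q , refl) , map-inverseˡ f b)
    (λ { (_ , (c , q , refl) , refl) → subst Q (sym (map-inverseˡ f c)) q }))

  ≤ᴮ-refl : (N : BStr M) → N ≤ᴮ N
  ≤ᴮ-refl _ _ q = q

  ≤ᴮ-trans : (N₁ N₂ N₃ : BStr M) → N₁ ≤ᴮ N₂ → N₂ ≤ᴮ N₃ → N₁ ≤ᴮ N₃
  ≤ᴮ-trans _ _ _ le le′ Q q = le′ Q (le Q q)

  permStr-mono : (f : M ↔ M) (N₁ N₂ : BStr M) → N₁ ≤ᴮ N₂ → permStr f N₁ ≤ᴮ permStr f N₂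
  permStr-mono f _ _ le R (Q , q , e) = Q , le Q q , e

  permStr-inverse-≤ᴮ : (f : M ↔ M) (N : BStr M) → permStr f (permStr (↔-sym f) N) ≤ᴮ N
  permStr-inverse-≤ᴮ f N R (Q′ , (Q , q , e′) , e) =
    rel-resp N (≅ᴿ-sym R≅Q) q
    where
    R≅Q : R ≅ᴿ Q
    R≅Q = ≅ᴿ-trans e (≅ᴿ-trans (imgRel-resp-≅ᴿ (Inverse.to f) e′)
                               (≅ᴿ-sym (imgRel-inverseˡ f Q)))

  ≤ᴮ-permStr-inverse : (f : M ↔ M) (N : BStr M) → N ≤ᴮ permStr f (permStr (↔-sym f) N)
  ≤ᴮ-permStr-inverse f N Q q =
    imgRel (Inverse.from f) Q , (Q , q , ≅ᴿ-refl) , imgRel-inverseˡ f Q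

  closedUnderPerm-from-≤ᴮ : (K : BStr M) → (∀ f → permStr f K ≤ᴮ K) → StrClosedUnderPerm K
  closedUnderPerm-from-≤ᴮ K shrinks f =
    shrinks f ,
    ≤ᴮ-trans K (permStr f (permStr (↔-sym f) K)) (permStr f K)
      (≤ᴮ-permStr-inverse f K) (permStr-mono f (permStr (↔-sym f) K) K (shrinks (↔-sym f)))

  closedUnderPerm-from-≥ᴮ : (K : BStr M) → (∀ f → K ≤ᴮ permStr f K) → StrClosedUnderPerm K
  closedUnderPerm-from-≥ᴮ K grows f =
    ≤ᴮ-trans (permStr f K) (permStr f (permStr (↔-sym f) K)) K
      (permStr-mono f K (permStr (↔-sym f) K) (grows (↔-sym f))) (permStr-inverse-≤ᴮ f K) ,
    grows f

  △-closedUnderPerm : (K : BStr M) → StrClosedUnderPerm K → SetClosedUnderPerm (△ K)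
  △-closedUnderPerm K closed f N N≤K =
    ≤ᴮ-trans (permStr f N) (permStr f K) K (permStr-mono f N K N≤K) (proj₁ (closed f))

  ▽-closedUnderPerm : (K : BStr M) → StrClosedUnderPerm K → SetClosedUnderPerm (▽ K)
  ▽-closedUnderPerm K closed f N K≤N =
    ≤ᴮ-trans K (permStr f K) (permStr f N) (proj₂ (closed f)) (permStr-mono f K N K≤N)

proposition5p2 : (M : Set) (K : BStr M) →
    ((SetClosedUnderPerm (△ K) ⇔ StrClosedUnderPerm K)
      × (SetClosedUnderPerm (▽ K) ⇔ StrClosedUnderPerm K))
proposition5p2 _ K =
  mk⇔ (λ closed△ → closedUnderPerm-from-≤ᴮ K (λ f → closed△ f K (≤ᴮ-refl K)))
      (△-closedUnderPerm K) ,
  mk⇔ (λ closed▽ → closedUnderPerm-from-≥ᴮ K (λ f → closed▽ f K (≤ᴮ-refl K)))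
      (▽-closedUnderPerm K)
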